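{- Let $H=\{0,\ldots,n-1\}\times\{0,\ldots,n-1\}$ and let $q$ be a positive integer. Let $Q$ be a set of $q$ queue-paths in $H$ such that the set $P(Q)$ of grid points covered by the paths of $Q$ has maximum cardinality among all sets of $q$ queue-paths in $H$. Then $P(Q)$ can be covered by $q$ queue-paths $p_0,\ldots,p_{q-1}$, where for each $i=0,\ldots,q-1$ the path $p_i$ consists of $2n-1-2i$ points, starts at $(0,i)$ and ends at $(n-1-i,n-1)$.
   Context: A queue-path is a sequence of distinct grid points $p_1,\ldots,p_m$ of $H$ such that each $p_{t+1}$ is coordinatewise greater than or equal to $p_t$ (a not necessarily strictly monotonically increasing path); it starts at $p_1$, ends at $p_m$, has length $m$, and covers the points $p_1,\ldots,p_m$. -}

module Defs where

open import Data.Nat using (ℕ; _≤_; _∸_; _*_)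
open import Data.Fin using (Fin; toℕ)
open import Data.Fin.Properties using (any?) renaming (_≟_ to _≟F_)
open import Data.Product using (_×_; _,_; Σ; ∃; proj₁; proj₂)
open import Data.Product.Properties using (≡-dec)
open import Data.List using (List; []; length; filter; allFin; cartesianProduct; head; last)
open import Data.List.Relation.Unary.Unique.Propositional using (Unique)
open import Data.List.Relation.Unary.Linked using (Linked)
open import Data.List.Membership.Propositional using (_∈_)
open import Data.List.Membership.DecPropositional using (_∈?_)
open import Data.Maybe using (Maybe; just)
open import Relation.Binary.PropositionalEquality using (_≡_; _≢_)
open import Relation.Binary.Definitions using (DecidableEquality)
open import Relation.Nullary using (Dec)

Point : ℕ → Set
Point n = Fin n × Fin n

_≟P_ : ∀ {n} → DecidableEquality (Point n)
_≟P_ = ≡-dec _≟F_ _≟F_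

_≤P_ : ∀ {n} → Point n → Point n → Set
(a , b) ≤P (c , d) = (toℕ a ≤ toℕ c) × (toℕ b ≤ toℕ d)

IsQueuePath : ∀ {n} → List (Point n) → Set
IsQueuePath ps = (ps ≢ []) × Unique ps × Linked _≤P_ ps

QueuePath : ℕ → Set
QueuePath n = Σ (List (Point n)) IsQueuePath

Distinct : ∀ {n q} → (Fin q → QueuePath n) → Set
Distinct Q = ∀ i j → proj₁ (Q i) ≡ proj₁ (Q j) → i ≡ j

Covered : ∀ {n q} → (Fin q → QueuePath n) → Point n → Set
Covered Q x = ∃ λ i → x ∈ proj₁ (Q i)

covered? : ∀ {n q} (Q : Fin q → QueuePath n) (x : Point n) → Dec (Covered Q x)
covered? Q x = any? (λ i → _∈?_ _≟P_ x (proj₁ (Q i)))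

allPoints : (n : ℕ) → List (Point n)
allPoints n = cartesianProduct (allFin n) (allFin n)

coveredCount : ∀ {n q} → (Fin q → QueuePath n) → ℕ
coveredCount {n} Q = length (filter (covered? Q) (allPoints n))

HasCoords : ∀ {n} → Maybe (Point n) → ℕ → ℕ → Set
HasCoords {n} m a b = ∃ λ (x : Point n) → (m ≡ just x) × (toℕ (proj₁ x) ≡ a) × (toℕ (proj₂ x) ≡ b)

-- On an antidiagonal x + y = k the grid points are pairwise incomparable, so a queue-path meets it
-- at most once and q paths cover at most min(q, |diagonal k|) of its points.  The q hooks
-- (0, j) → (n−1−j, j) → (n−1−j, n−1) reach this bound on every antidiagonal simultaneously, hence so
-- does a maximal family Q.  Number the covered points of each diagonal from the right, starting at 0,
-- and let path j pass through point number j of every diagonal k with j ≤ k ≤ 2n−2−j.  Bounding by q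
-- the antichains assembled from pieces of two consecutive diagonals shows that point number j moves
-- by a single unit step, right or up, from one diagonal to the next, so these are queue-paths.

module Submission where

open import Defs
open import Data.Nat using (ℕ; zero; suc; _+_; _*_; _∸_; _⊓_; _≤_; _<_; _≤′_; ≤′-refl; ≤′-step;
  z≤n; s≤s; s≤s⁻¹; z<s; s<s; _≤?_; _<?_)
open import Data.Fin using (Fin; toℕ)
open import Data.Fin.Properties using (toℕ≤pred[n]; toℕ<n; toℕ-injective)
import Data.Fin as Fin
open import Data.List using (List; []; _∷_; _++_; length; head; last; applyUpTo; filter; map; tabulate;
  allFin; cartesianProductWith)
open import Data.List.Properties using (length-applyUpTo; map-tabulate; filter-++; length-++)
open import Data.List.Membership.Propositional.Properties using (∈-applyUpTo⁺)
open import Data.List.Membership.Propositional using (_∈_)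
open import Data.List.Relation.Unary.All.Properties using (applyUpTo⁺₁)
open import Data.List.Relation.Unary.Linked using (Linked; []; [-]; _∷_)
open import Data.List.Relation.Unary.Unique.Propositional using (Unique)
open import Data.List.Relation.Unary.AllPairs using (AllPairs; []; _∷_)
import Data.List.Relation.Unary.All as All
open import Data.List.Relation.Unary.Any using (here; there)
open import Data.List.Relation.Unary.Linked.Properties using (Linked⇒AllPairs)
open import Data.List.Membership.DecPropositional using (_∈?_)
open import Data.Maybe using (just)
open import Data.Nat.Properties
open import Data.Product using (_×_; _,_; Σ; ∃; proj₁; proj₂)
open import Data.Sum using (_⊎_; inj₁; inj₂; [_,_]′)
open import Data.Empty using (⊥; ⊥-elim)
open import Data.Bool using (if_then_else_)
open import Function using (_∘_; id)
open import Relation.Nullary using (¬_; Dec; yes; no; does)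
open import Relation.Nullary.Decidable using (_×-dec_; _⊎-dec_; decidable-stable)
open import Relation.Unary using (Pred; Decidable)
open import Relation.Binary.PropositionalEquality
open import Data.Nat.Tactic.RingSolver using (solve-∀)
open import Algebra.Properties.CommutativeSemigroup +-commutativeSemigroup using (interchange)

∑ : ℕ → (ℕ → ℕ) → ℕ
∑ zero f = 0
∑ (suc n) f = f 0 + ∑ n (f ∘ suc)

∑-cong : ∀ n {f g : ℕ → ℕ} → (∀ x → x < n → f x ≡ g x) → ∑ n f ≡ ∑ n g
∑-cong zero h = refl
∑-cong (suc n) h = cong₂ _+_ (h 0 z<s) (∑-cong n (λ x p → h (suc x) (s≤s p)))

∑-mono : ∀ n {f g : ℕ → ℕ} → (∀ x → x < n → f x ≤ g x) → ∑ n f ≤ ∑ n g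
∑-mono zero h = z≤n
∑-mono (suc n) h = +-mono-≤ (h 0 z<s) (∑-mono n (λ x p → h (suc x) (s≤s p)))

∑-mono-< : ∀ n {f g : ℕ → ℕ} → (∀ x → x < n → f x ≤ g x) →
           ∀ t → t < n → f t < g t → ∑ n f < ∑ n g
∑-mono-< (suc n) h zero _ lt = +-mono-<-≤ lt (∑-mono n (λ x p → h (suc x) (s≤s p)))
∑-mono-< (suc n) h (suc t) (s≤s p) lt =
  +-mono-≤-< (h 0 z<s) (∑-mono-< n (λ x q → h (suc x) (s≤s q)) t p lt)

∑-zero : ∀ n {f : ℕ → ℕ} → (∀ x → x < n → f x ≡ 0) → ∑ n f ≡ 0
∑-zero zero h = refl
∑-zero (suc n) h = cong₂ _+_ (h 0 z<s) (∑-zero n (λ x p → h (suc x) (s≤s p)))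

∑-bounded : ∀ n {f : ℕ → ℕ} {c} → (∀ x → x < n → f x ≤ c) → ∑ n f ≤ n * c
∑-bounded zero h = z≤n
∑-bounded (suc n) h = +-mono-≤ (h 0 z<s) (∑-bounded n (λ x p → h (suc x) (s≤s p)))

term≤∑ : ∀ n (f : ℕ → ℕ) t → t < n → f t ≤ ∑ n f
term≤∑ (suc n) f zero _ = m≤m+n _ _
term≤∑ (suc n) f (suc t) (s≤s p) = ≤-trans (term≤∑ n (f ∘ suc) t p) (m≤n+m _ _)

∑-+ : ∀ n (f g : ℕ → ℕ) → ∑ n (λ x → f x + g x) ≡ ∑ n f + ∑ n g
∑-+ zero f g = refl
∑-+ (suc n) f g =
  trans (cong (f 0 + g 0 +_) (∑-+ n (f ∘ suc) (g ∘ suc))) (interchange (f 0) (g 0) _ _)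

∑-swap : ∀ a b (f : ℕ → ℕ → ℕ) → ∑ a (λ x → ∑ b (f x)) ≡ ∑ b (λ y → ∑ a (λ x → f x y))
∑-swap zero b f = sym (∑-zero b (λ _ _ → refl))
∑-swap (suc a) b f =
  trans (cong (∑ b (f 0) +_) (∑-swap a b (f ∘ suc))) (sym (∑-+ b (f 0) (λ y → ∑ a (λ x → f (suc x) y))))

∑-split : ∀ a b (f : ℕ → ℕ) → ∑ (a + b) f ≡ ∑ a f + ∑ b (λ k → f (a + k))
∑-split zero b f = refl
∑-split (suc a) b f = trans (cong (f 0 +_) (∑-split a b (f ∘ suc))) (sym (+-assoc (f 0) _ _))

∑-last : ∀ n (f : ℕ → ℕ) → ∑ (suc n) f ≡ ∑ n f + f n
∑-last n f = begin
  ∑ (suc n) f                     ≡⟨ cong (λ m → ∑ m f) (+-comm 1 n) ⟩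
  ∑ (n + 1) f                     ≡⟨ ∑-split n 1 f ⟩
  ∑ n f + (f (n + 0) + 0)         ≡⟨ cong (λ z → ∑ n f + (f z + 0)) (+-identityʳ n) ⟩
  ∑ n f + (f n + 0)               ≡⟨ cong (∑ n f +_) (+-identityʳ (f n)) ⟩
  ∑ n f + f n                     ∎
  where open ≡-Reasoning

∑-drop-prefix : ∀ a n (f : ℕ → ℕ) → (∀ k → k < a → f k ≡ 0) → ∑ (a + n) f ≡ ∑ n (λ k → f (a + k))
∑-drop-prefix a n f zeros = trans (∑-split a n f) (cong (_+ ∑ n (λ k → f (a + k))) (∑-zero a zeros))

∑-drop-suffix : ∀ n m (f : ℕ → ℕ) → (∀ s → s < m → f (n + s) ≡ 0) → ∑ (n + m) f ≡ ∑ n f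
∑-drop-suffix n m f zeros = trans (∑-split n m f) (trans (cong (∑ n f +_) (∑-zero m zeros)) (+-identityʳ _))

∑≤∑-suc : ∀ n (f : ℕ → ℕ) → ∑ n f ≤ ∑ (suc n) f
∑≤∑-suc n f = ≤-trans (m≤m+n (∑ n f) (f n)) (≤-reflexive (sym (∑-last n f)))

∑-tight : ∀ n {f g : ℕ → ℕ} → (∀ x → x < n → f x ≤ g x) → ∑ n g ≤ ∑ n f →
          ∀ x → x < n → f x ≡ g x
∑-tight (suc n) h tot zero _ =
  ≤-antisym (h 0 z<s) (+-cancelʳ-≤ _ _ _ (≤-trans tot (+-monoʳ-≤ _ (∑-mono n (λ x p → h (suc x) (s≤s p))))))
∑-tight (suc n) h tot (suc x) (s≤s p) =
  ∑-tight n (λ y q → h (suc y) (s≤s q)) (+-cancelˡ-≤ _ _ _ (≤-trans tot (+-monoˡ-≤ _ (h 0 z<s)))) x p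

χ : ∀ {p} {P : Set p} → Dec P → ℕ
χ (yes _) = 1
χ (no _) = 0

χ-yes : ∀ {p} {P : Set p} (P? : Dec P) → P → χ P? ≡ 1
χ-yes (yes _) _ = refl
χ-yes (no ¬p) p = ⊥-elim (¬p p)

χ-no : ∀ {p} {P : Set p} (P? : Dec P) → ¬ P → χ P? ≡ 0
χ-no (yes p) ¬p = ⊥-elim (¬p p)
χ-no (no _) _ = refl

χ-mono : ∀ {p r} {P : Set p} {R : Set r} → (P → R) → (P? : Dec P) (R? : Dec R) → χ P? ≤ χ R?
χ-mono f (yes p) (yes r) = ≤-refl
χ-mono f (yes p) (no ¬r) = ⊥-elim (¬r (f p))
χ-mono f (no ¬p) R? = z≤n

χ-cong : ∀ {p r} {P : Set p} {R : Set r} → (P → R) → (R → P) → (P? : Dec P) (R? : Dec R) → χ P? ≡ χ R?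
χ-cong f g P? R? = ≤-antisym (χ-mono f P? R?) (χ-mono g R? P?)

χ-⊎ : ∀ {p r} {P : Set p} {R : Set r} → (P → R → ⊥) → (P? : Dec P) (R? : Dec R) →
      χ (P? ⊎-dec R?) ≡ χ P? + χ R?
χ-⊎ excl (yes p) (yes r) = ⊥-elim (excl p r)
χ-⊎ excl (yes _) (no _) = refl
χ-⊎ excl (no _) (yes _) = refl
χ-⊎ excl (no _) (no _) = refl

count : ∀ {p} {P : Pred ℕ p} → ℕ → Decidable P → ℕ
count n P? = ∑ n (λ x → χ (P? x))

module _ {p r} {P : Pred ℕ p} {R : Pred ℕ r} (P? : Decidable P) (R? : Decidable R) where

  count-mono : ∀ n → (∀ x → x < n → P x → R x) → count n P? ≤ count n R?
  count-mono n f = ∑-mono n (λ x p → χ-mono (f x p) (P? x) (R? x))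

  count-cong : ∀ n → (∀ x → x < n → P x → R x) → (∀ x → x < n → R x → P x) → count n P? ≡ count n R?
  count-cong n f g = ∑-cong n (λ x p → χ-cong (f x p) (g x p) (P? x) (R? x))

from : ∀ {p} {P : Pred ℕ p} (t : ℕ) → Decidable P → Decidable (λ x → t ≤ x × P x)
from t P? x = (t ≤? x) ×-dec P? x

below : ∀ {p} {P : Pred ℕ p} (c : ℕ) → Decidable P → Decidable (λ x → x < c × P x)
below c P? x = (x <? c) ×-dec P? x

splice : ∀ {p r} {P : Pred ℕ p} {R : Pred ℕ r} (c : ℕ) → Decidable P → Decidable R →
         Decidable (λ x → c ≤ x × P x ⊎ x < c × R x)
splice c P? R? x = from c P? x ⊎-dec below c R? x

module _ {p} {P : Pred ℕ p} (P? : Decidable P) where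

  count-from-below : ∀ n c → count n P? ≡ count n (from c P?) + count n (below c P?)
  count-from-below n c = trans (∑-cong n (λ x _ → split x)) (∑-+ n _ _)
    where
    split : ∀ x → χ (P? x) ≡ χ (from c P? x) + χ (below c P? x)
    split x = trans (χ-cong side [ proj₂ , proj₂ ]′ (P? x) (from c P? x ⊎-dec below c P? x))
                    (χ-⊎ (λ (c≤x , _) (x<c , _) → <⇒≱ x<c c≤x) (from c P? x) (below c P? x))
      where
      side : P x → c ≤ x × P x ⊎ x < c × P x
      side p with c ≤? x
      ... | yes c≤x = inj₁ (c≤x , p)
      ... | no c≰x = inj₂ (≰⇒> c≰x , p)

  count-from-suc : ∀ n t → count n (from (suc t) P?) ≤ count n (from t P?)
  count-from-suc n t = count-mono (from (suc t) P?) (from t P?) n (λ _ _ (t<x , p) → <⇒≤ t<x , p)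

  count-from-skip : ∀ n {t} → ¬ P t → count n (from t P?) ≡ count n (from (suc t) P?)
  count-from-skip n {t} ¬p = count-cong (from t P?) (from (suc t) P?) n
    (λ x _ (t≤x , p) → ≤∧≢⇒< t≤x (λ { refl → ¬p p }) , p) (λ _ _ (t<x , p) → <⇒≤ t<x , p)

  count-from-step : ∀ n {t} → t < n → P t → count n (from (suc t) P?) < count n (from t P?)
  count-from-step n {t} t<n p =
    ∑-mono-< n (λ x _ → χ-mono (λ (t<x , p) → <⇒≤ t<x , p) (from (suc t) P? x) (from t P? x)) t t<n
      (subst₂ _<_ (sym (χ-no (from (suc t) P? t) (λ (t<t , _) → <-irrefl refl t<t)))
                  (sym (χ-yes (from t P? t) (≤-refl , p))) z<s)

  count-from-beyond : ∀ n {t} → n ≤ t → count n (from t P?) ≡ 0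
  count-from-beyond n n≤t =
    ∑-zero n (λ x x<n → χ-no (from _ P? x) (λ (t≤x , _) → <⇒≱ (<-≤-trans x<n n≤t) t≤x))

  count-from-0 : ∀ n → count n (from 0 P?) ≡ count n P?
  count-from-0 n = count-cong (from 0 P?) P? n (λ _ _ → proj₂) (λ _ _ p → z≤n , p)

module _ {p r} {P : Pred ℕ p} {R : Pred ℕ r} (P? : Decidable P) (R? : Decidable R) where

  count-⊎ : ∀ n → (∀ {x} → P x → R x → ⊥) → count n (λ x → P? x ⊎-dec R? x) ≡ count n P? + count n R?
  count-⊎ n excl = trans (∑-cong n (λ x _ → χ-⊎ excl (P? x) (R? x))) (∑-+ n _ _)

  count-tight : ∀ n → (∀ x → x < n → P x → R x) → count n R? ≤ count n P? → ∀ x → x < n → R x → P x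
  count-tight n P⊆R R≤P x x<n r with ∑-tight n (λ y y<n → χ-mono (P⊆R y y<n) (P? y) (R? y)) R≤P x x<n
  ... | eq with P? x | R? x
  ...   | yes p | _ = p
  ...   | no _ | yes _ = ⊥-elim (0≢1+n eq)
  ...   | no _ | no ¬r = ⊥-elim (¬r r)

count-splice : ∀ {p r} {P : Pred ℕ p} {R : Pred ℕ r} (P? : Decidable P) (R? : Decidable R) →
               ∀ n c → count n (splice c P? R?) + count n (from c R?) ≡
                       count n (from c P?) + count n R?
count-splice {P = P} {R} P? R? n c = begin
  count n (splice c P? R?) + fR  ≡⟨ cong (_+ fR) (count-⊎ (from c P?) (below c R?) n disjoint) ⟩
  fP + bR + fR                    ≡⟨ +-assoc fP bR fR ⟩
  fP + (bR + fR)                  ≡⟨ cong (fP +_) (+-comm bR fR) ⟩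
  fP + (fR + bR)                  ≡⟨ cong (fP +_) (sym (count-from-below R? n c)) ⟩
  fP + count n R?                 ∎
  where
  open ≡-Reasoning
  fP = count n (from c P?)
  fR = count n (from c R?)
  bR = count n (below c R?)
  disjoint : ∀ {x} → c ≤ x × P x → x < c × R x → ⊥
  disjoint (c≤x , _) (x<c , _) = <⇒≱ x<c c≤x

≤-exchange : ∀ {a b c d} → a + b ≡ c + d → a ≤ d → c ≤ b
≤-exchange {a} {b} {c} {d} eq a≤d = +-cancelʳ-≤ d c b (begin
  c + d    ≡⟨ sym eq ⟩
  a + b    ≤⟨ +-monoˡ-≤ b a≤d ⟩
  d + b    ≡⟨ +-comm d b ⟩
  b + d    ∎)
  where open ≤-Reasoning

count≤1 : ∀ {p} {P : Pred ℕ p} (P? : Decidable P) n →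
          (∀ x x' → x < x' → P x → P x' → ⊥) → count n P? ≤ 1
count≤1 P? zero _ = z≤n
count≤1 P? (suc n) once with P? 0
... | yes p0 = ≤-reflexive (cong suc (∑-zero n (λ x _ → absent x)))
  where
  absent : ∀ x → χ (P? (suc x)) ≡ 0
  absent x with P? (suc x)
  ... | yes px = ⊥-elim (once 0 (suc x) z<s p0 px)
  ... | no _ = refl
... | no _ = count≤1 (P? ∘ suc) n (λ x x' lt → once (suc x) (suc x') (s≤s lt))

count-interval : ∀ N a b → count N (from a (_≤? b)) ≡ suc b ⊓ N ∸ a
count-interval zero a b = sym (0∸n≡0 a)
count-interval (suc N) a b =
  trans (∑-last N (λ x → χ ((a ≤? x) ×-dec (x ≤? b))))
        (trans (cong (_+ χ ((a ≤? N) ×-dec (N ≤? b))) (count-interval N a b)) (step (N ≤? b) (a ≤? N)))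
  where
  step : (N≤b? : Dec (N ≤ b)) (a≤N? : Dec (a ≤ N)) →
         suc b ⊓ N ∸ a + χ (a≤N? ×-dec N≤b?) ≡ suc b ⊓ suc N ∸ a
  step (yes N≤b) a≤N? rewrite m≥n⇒m⊓n≡n (m≤n⇒m≤1+n N≤b) | m≥n⇒m⊓n≡n (s≤s N≤b) with a≤N?
  ... | yes a≤N = trans (+-comm (N ∸ a) 1) (sym (+-∸-assoc 1 a≤N))
  ... | no a≰N =
    trans (+-identityʳ _) (trans (m≤n⇒m∸n≡0 (<⇒≤ (≰⇒> a≰N))) (sym (m≤n⇒m∸n≡0 (≰⇒> a≰N))))
  step (no N≰b) a≤N?
    rewrite m≤n⇒m⊓n≡m (≰⇒> N≰b) | m≤n⇒m⊓n≡m (m≤n⇒m≤1+n (≰⇒> N≰b)) with a≤N?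
  ... | yes _ = +-identityʳ _
  ... | no _ = +-identityʳ _

antitone : ∀ (g : ℕ → ℕ) → (∀ t → g (suc t) ≤ g t) → ∀ {a b} → a ≤ b → g b ≤ g a
antitone g step a≤b = go (≤⇒≤′ a≤b)
  where
  go : ∀ {a b} → a ≤′ b → g b ≤ g a
  go ≤′-refl = ≤-refl
  go (≤′-step p) = ≤-trans (step _) (go p)

antitone-cut : ∀ (g : ℕ → ℕ) → (∀ t → g (suc t) ≤ g t) →
               ∀ {j a t} → g (suc a) ≤ j → j < g t → t ≤ a
antitone-cut g step {j} {a} {t} ga≤j j<gt with t ≤? a
... | yes t≤a = t≤a
... | no t≰a = ⊥-elim (<⇒≱ j<gt (≤-trans (antitone g step (≰⇒> t≰a)) ga≤j))

-- For antitone g this is the last position t with j < g t.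
threshold : (ℕ → ℕ) → ℕ → ℕ → ℕ
threshold g j n = count n (λ s → j <? g (suc s))

threshold-spec : ∀ n (g : ℕ → ℕ) → (∀ t → g (suc t) ≤ g t) → ∀ {j} → g (suc n) ≤ j → j < g 0 →
                 j < g (threshold g j n) × g (suc (threshold g j n)) ≤ j
threshold-spec zero g step top j<g0 = j<g0 , top
threshold-spec (suc n) g step {j} top j<g0 with j <? g 1
... | yes j<g1 = threshold-spec n (g ∘ suc) (step ∘ suc) top j<g1
... | no j≮g1 = subst (λ t → j < g t × g (suc t) ≤ j) (sym (∑-zero n absent)) (j<g0 , ≮⇒≥ j≮g1)
  where
  absent : ∀ s → s < n → χ (j <? g (suc (suc s))) ≡ 0
  absent s _ with j <? g (suc (suc s))
  ... | yes j<g = ⊥-elim (j≮g1 (<-≤-trans j<g (antitone g step (s≤s z≤n))))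
  ... | no _ = refl

module _ {a p} {A : Set a} {P : Pred A p} (P? : Decidable P) where

  length-filter-∷ : ∀ x xs → length (filter P? (x ∷ xs)) ≡ χ (P? x) + length (filter P? xs)
  length-filter-∷ x xs with P? x
  ... | yes _ = refl
  ... | no _ = refl

  length-filter-tabulate : ∀ m (f : Fin m → A) (h : ℕ → ℕ) → (∀ i → χ (P? (f i)) ≡ h (toℕ i)) →
                           length (filter P? (tabulate f)) ≡ ∑ m h
  length-filter-tabulate zero f h eq = refl
  length-filter-tabulate (suc m) f h eq = trans (length-filter-∷ (f Fin.zero) (tabulate (f ∘ Fin.suc)))
    (cong₂ _+_ (eq Fin.zero) (length-filter-tabulate m (f ∘ Fin.suc) (h ∘ suc) (eq ∘ Fin.suc)))

  length-filter-cartesianProduct : ∀ {b c} {B : Set b} {C : Set c} m (f : Fin m → B) (ys : List C)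
    (g : B → C → A) (h : ℕ → ℕ) → (∀ i → length (filter P? (map (g (f i)) ys)) ≡ h (toℕ i)) →
    length (filter P? (cartesianProductWith g (tabulate f) ys)) ≡ ∑ m h
  length-filter-cartesianProduct zero f ys g h eq = refl
  length-filter-cartesianProduct (suc m) f ys g h eq = begin
    length (filter P? (row ++ rest))               ≡⟨ cong length (filter-++ P? row rest) ⟩
    length (filter P? row ++ filter P? rest)       ≡⟨ length-++ (filter P? row) ⟩
    length (filter P? row) + length (filter P? rest)
      ≡⟨ cong₂ _+_ (eq Fin.zero) (length-filter-cartesianProduct m (f ∘ Fin.suc) ys g (h ∘ suc) (eq ∘ Fin.suc)) ⟩
    h 0 + ∑ m (h ∘ suc)                             ∎
    where
    open ≡-Reasoning
    row = map (g (f Fin.zero)) ys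
    rest = cartesianProductWith g (tabulate (f ∘ Fin.suc)) ys

length-filter-allPoints : ∀ {n p} {P : Pred (Point n) p} (P? : Decidable P) (h : ℕ → ℕ → ℕ) →
  (∀ a b → χ (P? (a , b)) ≡ h (toℕ a) (toℕ b)) → length (filter P? (allPoints n)) ≡ ∑ n (λ x → ∑ n (h x))
length-filter-allPoints {n} P? h eq =
  length-filter-cartesianProduct P? n (λ a → a) (allFin n) _,_ (λ x → ∑ n (h x)) λ a →
    trans (cong (length ∘ filter P?) (map-tabulate (λ b → b) (a ,_)))
          (length-filter-tabulate P? n (a ,_) (h (toℕ a)) (eq a))

allPairs-∈ : ∀ {a r} {A : Set a} {R : A → A → Set r} {xs x y} →
             AllPairs R xs → x ∈ xs → y ∈ xs → x ≡ y ⊎ R x y ⊎ R y x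
allPairs-∈ (_ ∷ _) (here refl) (here refl) = inj₁ refl
allPairs-∈ (rs ∷ _) (here refl) (there y∈) = inj₂ (inj₁ (All.lookup rs y∈))
allPairs-∈ (rs ∷ _) (there x∈) (here refl) = inj₂ (inj₂ (All.lookup rs x∈))
allPairs-∈ (_ ∷ rss) (there x∈) (there y∈) = allPairs-∈ rss x∈ y∈

≤P-trans : ∀ {n} {a b c : Point n} → a ≤P b → b ≤P c → a ≤P c
≤P-trans (x₁ , y₁) (x₂ , y₂) = ≤-trans x₁ x₂ , ≤-trans y₁ y₂

module _ {a} {A : Set a} where

  last-applyUpTo : ∀ (F : ℕ → A) l → last (applyUpTo F (suc l)) ≡ just (F l)
  last-applyUpTo F zero = refl
  last-applyUpTo F (suc l) = last-applyUpTo (F ∘ suc) l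

  applyUpTo-unique : ∀ (F : ℕ → A) l → (∀ {s t} → s < t → t < l → F s ≢ F t) → Unique (applyUpTo F l)
  applyUpTo-unique F zero distinct = []
  applyUpTo-unique F (suc l) distinct =
    applyUpTo⁺₁ (F ∘ suc) l (λ t<l → distinct z<s (s<s t<l))
    ∷ applyUpTo-unique (F ∘ suc) l (λ s<t t<l → distinct (s<s s<t) (s<s t<l))

  applyUpTo-linked : ∀ {r} {R : A → A → Set r} (F : ℕ → A) l →
                     (∀ {s} → suc s < l → R (F s) (F (suc s))) → Linked R (applyUpTo F l)
  applyUpTo-linked F zero step = []
  applyUpTo-linked F (suc zero) step = [-]
  applyUpTo-linked F (suc (suc l)) step = step (s<s z<s) ∷ applyUpTo-linked (F ∘ suc) (suc l) (step ∘ s<s)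

-- Arguments above m are sent to m; every use below stays within range.
clamp : ∀ {m} → ℕ → Fin (suc m)
clamp {zero} _ = Fin.zero
clamp {suc m} zero = Fin.zero
clamp {suc m} (suc x) = Fin.suc (clamp x)

toℕ-clamp : ∀ {m x} → x ≤ m → toℕ (clamp {m} x) ≡ x
toℕ-clamp {zero} z≤n = refl
toℕ-clamp {suc m} z≤n = refl
toℕ-clamp {suc m} (s≤s x≤m) = cong suc (toℕ-clamp x≤m)

clamp-toℕ : ∀ {m} (i : Fin (suc m)) → clamp (toℕ i) ≡ i
clamp-toℕ {zero} Fin.zero = refl
clamp-toℕ {suc m} Fin.zero = refl
clamp-toℕ {suc m} (Fin.suc i) = cong Fin.suc (clamp-toℕ i)

staircase-length : ∀ j e → suc (e + e) ≡ 2 * suc (j + e) ∸ 1 ∸ 2 * j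
staircase-length j e = sym (trans (cong (_∸ 2 * j) (twice j e)) (m+n∸m≡n (2 * j) (suc (e + e))))
  where
  twice : ∀ j e → (j + e) + suc ((j + e) + 0) ≡ 2 * j + suc (e + e)
  twice = solve-∀

module Grid (n' : ℕ) where

  N : ℕ
  N = suc n'

  pt : ℕ → ℕ → Point N
  pt x y = clamp x , clamp y

  pt-toℕ : ∀ (a b : Fin N) → pt (toℕ a) (toℕ b) ≡ (a , b)
  pt-toℕ a b = cong₂ _,_ (clamp-toℕ a) (clamp-toℕ b)

  hasCoords-pt : ∀ {x y} → x ≤ n' → y ≤ n' → HasCoords (just (pt x y)) x y
  hasCoords-pt x≤n' y≤n' = _ , refl , toℕ-clamp x≤n' , toℕ-clamp y≤n'

  -- The staircase meets the diagonals j, j + 1, …, j + l in turn, diagonal j + s at x-coordinate Z s.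
  module Staircase (j l : ℕ) (Z : ℕ → ℕ) where

    stairPoint : ℕ → Point N
    stairPoint s = pt (Z s) (j + s ∸ Z s)

    stair : List (Point N)
    stair = applyUpTo stairPoint (suc l)

    stair-length : length stair ≡ suc l
    stair-length = length-applyUpTo stairPoint (suc l)

    stair-head : Z 0 ≤ n' → j + 0 ∸ Z 0 ≤ n' → HasCoords (head stair) (Z 0) (j + 0 ∸ Z 0)
    stair-head = hasCoords-pt

    stair-last : Z l ≤ n' → j + l ∸ Z l ≤ n' → HasCoords (last stair) (Z l) (j + l ∸ Z l)
    stair-last x≤n' y≤n' =
      subst (λ m → HasCoords m (Z l) (j + l ∸ Z l)) (sym (last-applyUpTo stairPoint l)) (hasCoords-pt x≤n' y≤n')

    stair-∋ : ∀ {s} → s ≤ l → stairPoint s ∈ stair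
    stair-∋ s≤l = ∈-applyUpTo⁺ stairPoint (s≤s s≤l)

    stair-isQueuePath : (∀ s → s ≤ l → Z s ≤ j + s × Z s ≤ n' × j + s ∸ Z s ≤ n') →
                        (∀ s → s < l → Z s ≤ Z (suc s) × Z (suc s) ≤ suc (Z s)) → IsQueuePath stair
    stair-isQueuePath in-grid step =
      (λ ()) , applyUpTo-unique stairPoint (suc l) distinct , applyUpTo-linked stairPoint (suc l) monotone
      where
      toℕ-stairPoint : ∀ {s} → s ≤ l →
                       toℕ (proj₁ (stairPoint s)) ≡ Z s × toℕ (proj₂ (stairPoint s)) ≡ j + s ∸ Z s
      toℕ-stairPoint s≤l = let (_ , x≤ , y≤) = in-grid _ s≤l in toℕ-clamp x≤ , toℕ-clamp y≤

      diagonal : ∀ {s} → s ≤ l → toℕ (proj₁ (stairPoint s)) + toℕ (proj₂ (stairPoint s)) ≡ j + s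
      diagonal s≤l with toℕ-stairPoint s≤l
      ... | eqx , eqy = trans (cong₂ _+_ eqx eqy) (m+[n∸m]≡n (proj₁ (in-grid _ s≤l)))

      distinct : ∀ {s t} → s < t → t < suc l → stairPoint s ≢ stairPoint t
      distinct {s} {t} s<t (s≤s t≤l) eq = <⇒≢ s<t (+-cancelˡ-≡ j _ _
        (trans (sym (diagonal (≤-trans (<⇒≤ s<t) t≤l)))
          (trans (cong (λ p → toℕ (proj₁ p) + toℕ (proj₂ p)) eq) (diagonal t≤l))))

      monotone : ∀ {s} → suc s < suc l → stairPoint s ≤P stairPoint (suc s)
      monotone {s} (s≤s s<l)
        rewrite proj₁ (toℕ-stairPoint (<⇒≤ s<l)) | proj₂ (toℕ-stairPoint (<⇒≤ s<l))
              | proj₁ (toℕ-stairPoint s<l) | proj₂ (toℕ-stairPoint s<l) | +-suc j s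
        = proj₁ (step s s<l) , ∸-monoʳ-≤ (suc (j + s)) (proj₂ (step s s<l))

  offset≤ : ∀ {j k} → j ≤ n' → j ≤ k → j + k ≤ n' + n' → k ∸ j ≤ (n' ∸ j) + (n' ∸ j)
  offset≤ {j} {k} j≤n' j≤k j+k≤ = +-cancelʳ-≤ (j + j) _ _ (begin
    k ∸ j + (j + j)                ≡⟨ sym (+-assoc (k ∸ j) j j) ⟩
    k ∸ j + j + j                  ≡⟨ cong (_+ j) (m∸n+n≡m j≤k) ⟩
    k + j                          ≡⟨ +-comm k j ⟩
    j + k                          ≤⟨ j+k≤ ⟩
    n' + n'                        ≡⟨ sym (cong₂ _+_ (m∸n+n≡m j≤n') (m∸n+n≡m j≤n')) ⟩
    (n' ∸ j + j) + (n' ∸ j + j)    ≡⟨ interchange (n' ∸ j) j (n' ∸ j) j ⟩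
    (n' ∸ j + (n' ∸ j)) + (j + j)  ∎)
    where open ≤-Reasoning

  offset≥ : ∀ {j s} → j ≤ n' → s ≤ (n' ∸ j) + (n' ∸ j) → j + (j + s) ≤ n' + n'
  offset≥ {j} {s} j≤n' s≤ = begin
    j + (j + s)                    ≤⟨ +-monoʳ-≤ j (+-monoʳ-≤ j s≤) ⟩
    j + (j + (e + e))              ≡⟨ cong (j +_) (sym (+-assoc j e e)) ⟩
    j + (j + e + e)                ≡⟨ cong (λ m → j + (m + e)) je ⟩
    j + (n' + e)                   ≡⟨ cong (j +_) (+-comm n' e) ⟩
    j + (e + n')                   ≡⟨ sym (+-assoc j e n') ⟩
    j + e + n'                     ≡⟨ cong (_+ n') je ⟩
    n' + n'                        ∎
    where
    open ≤-Reasoning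
    e = n' ∸ j
    je = m+[n∸m]≡n j≤n'

  OnGrid : ℕ → ℕ → Set
  OnGrid k x = k ∸ n' ≤ x × x ≤ k

  onGrid? : ∀ k → Decidable (OnGrid k)
  onGrid? k x = (k ∸ n' ≤? x) ×-dec (x ≤? k)

  gridFrom : ℕ → ℕ → ℕ
  gridFrom k t = count N (from t (onGrid? k))

  diagSize : ℕ → ℕ
  diagSize k = count N (onGrid? k)

  gridFrom-low : ∀ k {t} → t ≤ k ∸ n' → gridFrom k t ≡ diagSize k
  gridFrom-low k t≤ =
    count-cong (from _ (onGrid? k)) (onGrid? k) N (λ _ _ → proj₂) (λ _ _ g → ≤-trans t≤ (proj₁ g) , g)

  gridFrom≤ : ∀ k t → gridFrom k t ≤ suc k ⊓ N ∸ t
  gridFrom≤ k t = ≤-trans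
    (count-mono (from t (onGrid? k)) (from t (_≤? k)) N (λ _ _ (t≤x , _ , x≤k) → t≤x , x≤k))
    (≤-reflexive (count-interval N t k))

  diagSize-≤n' : ∀ {k} → k ≤ n' → diagSize k ≡ suc k
  diagSize-≤n' {k} k≤n' =
    trans (count-interval N (k ∸ n') k) (cong₂ _∸_ (m≤n⇒m⊓n≡m (s≤s k≤n')) (m≤n⇒m∸n≡0 k≤n'))

  diagSize-N+ : ∀ r → diagSize (N + r) ≡ n' ∸ r
  diagSize-N+ r = begin
    diagSize (N + r)                ≡⟨ count-interval N (N + r ∸ n') (N + r) ⟩
    suc (N + r) ⊓ N ∸ (N + r ∸ n')  ≡⟨ cong₂ _∸_ (m≥n⇒m⊓n≡n (m≤n⇒m≤1+n (m≤m+n N r))) low ⟩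
    N ∸ suc r                       ∎
    where
    open ≡-Reasoning
    low : N + r ∸ n' ≡ suc r
    low = trans (cong (_∸ n') (sym (+-suc n' r))) (m+n∸m≡n n' (suc r))

  gridFrom-suc : ∀ k t → gridFrom k t ⊓ diagSize (suc k) ≤ gridFrom (suc k) t
  gridFrom-suc k t with suc k ∸ n' ≤? t
  ... | yes low≤t = ≤-trans (m⊓n≤m _ _) (count-mono (from t (onGrid? k)) (from t (onGrid? (suc k))) N
          (λ x _ (t≤x , _ , x≤k) → t≤x , ≤-trans low≤t t≤x , m≤n⇒m≤1+n x≤k))
  ... | no low≰t = ≤-trans (m⊓n≤n _ _) (≤-reflexive (sym (gridFrom-low (suc k) (<⇒≤ (≰⇒> low≰t)))))

  gridFrom-pred : ∀ k s → gridFrom (suc k) (suc s) ⊓ diagSize k ≤ gridFrom k s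
  gridFrom-pred k s with k ∸ n' ≤? s
  ... | yes low≤s = ≤-trans (m⊓n≤m _ _) (+-mono-≤ (≤-reflexive (χ-no (from (suc s) (onGrid? (suc k)) 0) (λ ())))
          (≤-trans (count-mono (from (suc s) (onGrid? (suc k)) ∘ suc) (from s (onGrid? k)) n'
                     (λ x _ (s<x , _ , x<k) → s≤s⁻¹ s<x , ≤-trans low≤s (s≤s⁻¹ s<x) , s≤s⁻¹ x<k))
                   (∑≤∑-suc n' (λ x → χ (from s (onGrid? k) x)))))
  ... | no low≰s = ≤-trans (m⊓n≤n _ _) (≤-reflexive (sym (gridFrom-low k (<⇒≤ (≰⇒> low≰s)))))

  diagSize≤ : ∀ k → diagSize k ≤ suc (k ⊓ n')
  diagSize≤ k = ≤-trans (≤-reflexive (count-interval N (k ∸ n') k)) (m∸n≤m (suc k ⊓ N) (k ∸ n'))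

  small-or-large : ∀ k → k ≤ n' ⊎ ∃ λ r → k ≡ N + r
  small-or-large k with k ≤? n'
  ... | yes k≤n' = inj₁ k≤n'
  ... | no k≰n' = inj₂ (_ , sym (proj₂ (m≤n⇒∃[o]m+o≡n (≰⇒> k≰n'))))

  <diagSize⇒ : ∀ {j k} → j < diagSize k → j ≤ k × j + k ≤ n' + n'
  <diagSize⇒ {j} {k} j<d with small-or-large k
  ... | inj₁ k≤n' = j≤k , +-mono-≤ (≤-trans j≤k k≤n') k≤n'
    where j≤k = s≤s⁻¹ (subst (j <_) (diagSize-≤n' k≤n') j<d)
  ... | inj₂ (r , refl) =
    ≤-trans (m≤m+n j r) (≤-trans (n≤1+n (j + r)) (≤-trans 1+j+r≤n' (m≤n⇒m≤1+n (m≤m+n n' r)))) ,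
    subst (_≤ n' + n') (shuffle j n' r) (+-monoˡ-≤ n' 1+j+r≤n')
    where
    j<n'∸r : j < n' ∸ r
    j<n'∸r = subst (j <_) (diagSize-N+ r) j<d
    1+j+r≤n' : suc j + r ≤ n'
    1+j+r≤n' = m≤o∸n⇒m+n≤o (suc j) (<⇒≤ (m∸n≢0⇒n<m (λ z → n≮0 (subst (j <_) z j<n'∸r)))) j<n'∸r
    shuffle : ∀ j n' r → suc j + r + n' ≡ j + (suc n' + r)
    shuffle = solve-∀

  <diagSize⇐ : ∀ {j k} → j ≤ k → j + k ≤ n' + n' → j < diagSize k
  <diagSize⇐ {j} {k} j≤k j+k≤ with small-or-large k
  ... | inj₁ k≤n' = subst (j <_) (sym (diagSize-≤n' k≤n')) (s≤s j≤k)
  ... | inj₂ (r , refl) = subst (j <_) (sym (diagSize-N+ r))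
    (m+n≤o⇒m≤o∸n (suc j) (+-cancelʳ-≤ n' _ _ (subst (_≤ n' + n') (shuffle j n' r) j+k≤)))
    where
    shuffle : ∀ j n' r → j + (suc n' + r) ≡ suc j + r + n'
    shuffle = solve-∀

module Coverage (n' q' : ℕ) (Q : Fin (suc q') → QueuePath (suc n')) where
  open Grid n'

  q : ℕ
  q = suc q'

  CoveredAt : ℕ → ℕ → Set
  CoveredAt x y = x ≤ n' × y ≤ n' × Covered Q (pt x y)

  coveredAt? : ∀ x y → Dec (CoveredAt x y)
  coveredAt? x y = (x ≤? n') ×-dec (y ≤? n') ×-dec covered? Q (pt x y)

  CoveredOn : ℕ → ℕ → Set
  CoveredOn k x = x ≤ k × CoveredAt x (k ∸ x)

  coveredOn? : ∀ k → Decidable (CoveredOn k)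
  coveredOn? k x = (x ≤? k) ×-dec coveredAt? x (k ∸ x)

  coveredOnDiag : ℕ → ℕ
  coveredOnDiag k = count N (coveredOn? k)

  coveredFrom : ℕ → ℕ → ℕ
  coveredFrom k t = count N (from t (coveredOn? k))

  covered⇒coveredAt : ∀ {a b : Fin N} → Covered Q (a , b) → CoveredAt (toℕ a) (toℕ b)
  covered⇒coveredAt {a} {b} cv = toℕ≤pred[n] a , toℕ≤pred[n] b , subst (Covered Q) (sym (pt-toℕ a b)) cv

  χ-covered : ∀ (a b : Fin N) → χ (covered? Q (a , b)) ≡ χ (coveredAt? (toℕ a) (toℕ b))
  χ-covered a b = χ-cong covered⇒coveredAt (subst (Covered Q) (pt-toℕ a b) ∘ proj₂ ∘ proj₂)
                         (covered? Q (a , b)) (coveredAt? (toℕ a) (toℕ b))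

  column-by-diagonals : ∀ x → x ≤ N → ∑ N (λ y → χ (coveredAt? x y)) ≡ ∑ (N + N) (λ k → χ (coveredOn? k x))
  column-by-diagonals x x≤N = sym (begin
    ∑ (N + N) g                    ≡⟨ cong (λ m → ∑ m g) (sym (m+[n∸m]≡n x≤N+N)) ⟩
    ∑ (x + (N + N ∸ x)) g          ≡⟨ ∑-drop-prefix x (N + N ∸ x) g before-column ⟩
    ∑ (N + N ∸ x) (λ k → g (x + k)) ≡⟨ ∑-cong (N + N ∸ x) (λ k _ → χ-cong to (back k) (coveredOn? (x + k) x) (coveredAt? x k)) ⟩
    ∑ (N + N ∸ x) h                ≡⟨ cong (λ m → ∑ m h) (+-∸-assoc N x≤N) ⟩
    ∑ (N + (N ∸ x)) h              ≡⟨ ∑-drop-suffix N (N ∸ x) h above-grid ⟩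
    ∑ N h                          ∎)
    where
    open ≡-Reasoning
    g h : ℕ → ℕ
    g k = χ (coveredOn? k x)
    h y = χ (coveredAt? x y)
    before-column : ∀ k → k < x → g k ≡ 0
    before-column k k<x = χ-no (coveredOn? k x) (λ (x≤k , _) → <⇒≱ k<x x≤k)
    above-grid : ∀ s → s < N ∸ x → h (N + s) ≡ 0
    above-grid s _ = χ-no (coveredAt? x (N + s)) (λ (_ , y≤n' , _) → <⇒≱ (s≤s (m≤m+n n' s)) y≤n')
    x≤N+N : x ≤ N + N
    x≤N+N = ≤-trans x≤N (m≤m+n N N)
    to : ∀ {k} → CoveredOn (x + k) x → CoveredAt x k
    to {k} (_ , c) = subst (CoveredAt x) (m+n∸m≡n x k) c
    back : ∀ k → CoveredAt x k → CoveredOn (x + k) x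
    back k c = m≤m+n x k , subst (CoveredAt x) (sym (m+n∸m≡n x k)) c

  coveredCount≡∑ : coveredCount Q ≡ ∑ (N + N) coveredOnDiag
  coveredCount≡∑ = begin
    coveredCount Q
      ≡⟨ length-filter-allPoints (covered? Q) (λ x y → χ (coveredAt? x y)) χ-covered ⟩
    ∑ N (λ x → ∑ N (λ y → χ (coveredAt? x y)))
      ≡⟨ ∑-cong N (λ x x<N → column-by-diagonals x (<⇒≤ x<N)) ⟩
    ∑ N (λ x → ∑ (N + N) (λ k → χ (coveredOn? k x)))
      ≡⟨ ∑-swap N (N + N) (λ x k → χ (coveredOn? k x)) ⟩
    ∑ (N + N) coveredOnDiag
      ∎
    where open ≡-Reasoning

  OnPath : ℕ → ℕ → ℕ → Set
  OnPath i x y = pt x y ∈ proj₁ (Q (clamp i))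

  -- Each path meets an antichain at most once, since any two points of a queue-path are comparable.
  antichain≤q : ∀ {p} {S : Pred ℕ p} (S? : Decidable S) (Y : ℕ → ℕ) →
    (∀ {x} → S x → CoveredAt x (Y x)) → (∀ {x x'} → x < x' → S x → S x' → Y x' < Y x) →
    count N S? ≤ q
  antichain≤q {S = S} S? Y covered antichain = begin
    count N S?                                      ≤⟨ ∑-mono N (λ x _ → someone x) ⟩
    ∑ N (λ x → ∑ q (λ i → χ (onPath? i x)))         ≡⟨ ∑-swap N q (λ x i → χ (onPath? i x)) ⟩
    ∑ q (λ i → count N (onPath? i))                 ≤⟨ ∑-bounded q (λ i _ → count≤1 (onPath? i) N (once i)) ⟩
    q * 1                                           ≡⟨ *-identityʳ q ⟩
    q                                               ∎
    where
    open ≤-Reasoning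
    onPath? : ∀ i → Decidable (λ x → S x × OnPath i x (Y x))
    onPath? i x = S? x ×-dec _∈?_ _≟P_ (pt x (Y x)) (proj₁ (Q (clamp i)))

    someone : ∀ x → χ (S? x) ≤ ∑ q (λ i → χ (onPath? i x))
    someone x = on-some-path (S? x)
      where
      on-some-path : (S?x : Dec (S x)) → χ S?x ≤ ∑ q (λ i → χ (onPath? i x))
      on-some-path (no _) = z≤n
      on-some-path (yes s) with covered s
      ... | _ , _ , i , ∈Qi = ≤-trans (≤-reflexive (sym (χ-yes (onPath? (toℕ i) x) (s , on-i))))
                                      (term≤∑ q (λ i → χ (onPath? i x)) (toℕ i) (toℕ<n i))
        where on-i = subst (λ j → pt x (Y x) ∈ proj₁ (Q j)) (sym (clamp-toℕ i)) ∈Qi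

    once : ∀ i x x' → x < x' → S x × OnPath i x (Y x) → S x' × OnPath i x' (Y x') → ⊥
    once i x x' x<x' (s , ∈Q) (s' , ∈Q') with covered s | covered s'
    ... | x≤ , y≤ , _ | x'≤ , y'≤ , _
      with allPairs-∈ (Linked⇒AllPairs ≤P-trans (proj₂ (proj₂ (proj₂ (Q (clamp i)))))) ∈Q ∈Q'
    ... | inj₁ eq = <⇒≢ x<x' (trans (sym (toℕ-clamp x≤)) (trans (cong (toℕ ∘ proj₁) eq) (toℕ-clamp x'≤)))
    ... | inj₂ (inj₁ (_ , y≤y')) =
      <⇒≱ (antichain x<x' s s') (subst₂ _≤_ (toℕ-clamp y≤) (toℕ-clamp y'≤) y≤y')
    ... | inj₂ (inj₂ (x'≤x , _)) = <⇒≱ x<x' (subst₂ _≤_ (toℕ-clamp x'≤) (toℕ-clamp x≤) x'≤x)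

-- Hook j runs from (0, j) right to (n' − j, j) and then up to (n' − j, n').
module Hooks (n' q' : ℕ) (q'≤n' : q' ≤ n') where
  open Grid n'

  q : ℕ
  q = suc q'

  hook-in-grid : ∀ {j} → j ≤ n' → ∀ s → s ≤ (n' ∸ j) + (n' ∸ j) →
                 s ⊓ (n' ∸ j) ≤ j + s × s ⊓ (n' ∸ j) ≤ n' × j + s ∸ s ⊓ (n' ∸ j) ≤ n'
  hook-in-grid {j} j≤n' s s≤2e =
    ≤-trans (m⊓n≤m s e) (m≤n+m s j) , ≤-trans (m⊓n≤n s e) (m∸n≤m n' j) , rise (s ≤? e)
    where
    e = n' ∸ j
    rise : Dec (s ≤ e) → j + s ∸ s ⊓ e ≤ n'
    rise (yes s≤e) rewrite m≤n⇒m⊓n≡m s≤e | m+n∸n≡m j s = j≤n'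
    rise (no s≰e) rewrite m≥n⇒m⊓n≡n (<⇒≤ (≰⇒> s≰e)) = m≤n+o⇒m∸n≤o (j + s) e (begin
      j + s            ≤⟨ +-monoʳ-≤ j s≤2e ⟩
      j + (e + e)      ≡⟨ sym (+-assoc j e e) ⟩
      j + e + e        ≡⟨ cong (_+ e) (m+[n∸m]≡n j≤n') ⟩
      n' + e           ≡⟨ +-comm n' e ⟩
      e + n'           ∎)
      where open ≤-Reasoning

  hook : ℕ → List (Point N)
  hook j = Staircase.stair j ((n' ∸ j) + (n' ∸ j)) (_⊓ (n' ∸ j))

  hook-isQueuePath : ∀ {j} → j ≤ n' → IsQueuePath (hook j)
  hook-isQueuePath {j} j≤n' = Staircase.stair-isQueuePath j _ _ (hook-in-grid j≤n')
    (λ s _ → ⊓-monoˡ-≤ (n' ∸ j) (n≤1+n s) , ⊓-monoʳ-≤ (suc s) (n≤1+n (n' ∸ j)))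

  i≤n' : (i : Fin q) → toℕ i ≤ n'
  i≤n' i = ≤-trans (toℕ≤pred[n] i) q'≤n'

  hooks : Fin q → QueuePath N
  hooks i = hook (toℕ i) , hook-isQueuePath (i≤n' i)

  hooks-distinct : Distinct hooks
  hooks-distinct i i' eq = toℕ-injective (+-cancelʳ-≡ 0 _ _ (begin
    toℕ i + 0                      ≡⟨ sym (toℕ-clamp (start≤n' i)) ⟩
    toℕ (clamp {n'} (toℕ i + 0))   ≡⟨ cong (λ { (p ∷ _) → toℕ (proj₂ p) ; [] → 0 }) eq ⟩
    toℕ (clamp {n'} (toℕ i' + 0))  ≡⟨ toℕ-clamp (start≤n' i') ⟩
    toℕ i' + 0                     ∎))
    where
    open ≡-Reasoning
    start≤n' : ∀ i → toℕ i + 0 ≤ n'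
    start≤n' i = ≤-trans (≤-reflexive (+-identityʳ _)) (i≤n' i)

  module H = Coverage n' q' hooks

  hook-covers : ∀ {j k} → j < q → j < diagSize k → H.CoveredOn k (k ⊓ n' ∸ j)
  hook-covers {j} {k} j<q j<d =
    subst₂ _≤_ x≡ k≡ x≤ ,
    subst (_≤ n') x≡ x≤n' ,
    subst₂ (λ u v → u ∸ v ≤ n') k≡ x≡ y≤n' ,
    clamp j , subst₂ (λ i x → pt x (k ∸ x) ∈ hook i) (sym (toℕ-clamp j≤q')) x≡ on-hook
    where
    j≤q' = s≤s⁻¹ j<q
    j≤n' = ≤-trans j≤q' q'≤n'
    e = n' ∸ j
    s = k ∸ j
    j≤k = proj₁ (<diagSize⇒ j<d)
    k≡ : j + s ≡ k
    k≡ = m+[n∸m]≡n j≤k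
    x≡ : s ⊓ e ≡ k ⊓ n' ∸ j
    x≡ = sym (∸-distribʳ-⊓ j k n')
    s≤2e : s ≤ e + e
    s≤2e = offset≤ j≤n' j≤k (proj₂ (<diagSize⇒ j<d))
    grid = hook-in-grid j≤n' s s≤2e
    x≤ = proj₁ grid
    x≤n' = proj₁ (proj₂ grid)
    y≤n' = proj₂ (proj₂ grid)
    on-hook : pt (s ⊓ e) (k ∸ s ⊓ e) ∈ hook j
    on-hook = subst (λ u → pt (s ⊓ e) (u ∸ s ⊓ e) ∈ hook j) k≡ (Staircase.stair-∋ j (e + e) (_⊓ e) s≤2e)

  hooks-coveredOnDiag : ∀ k → q ⊓ diagSize k ≤ H.coveredOnDiag k
  hooks-coveredOnDiag k = begin
    m                                    ≡⟨ sym (m∸[m∸n]≡n m≤1+b) ⟩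
    suc b ∸ (suc b ∸ m)                  ≡⟨ cong (_∸ (suc b ∸ m)) (sym (m≤n⇒m⊓n≡m (s≤s (m⊓n≤n k n')))) ⟩
    suc b ⊓ N ∸ (suc b ∸ m)              ≡⟨ sym (count-interval N (suc b ∸ m) b) ⟩
    count N (from (suc b ∸ m) (_≤? b))   ≤⟨ count-mono (from (suc b ∸ m) (_≤? b)) (H.coveredOn? k) N (λ x _ → covered x) ⟩
    H.coveredOnDiag k                    ∎
    where
    open ≤-Reasoning
    b = k ⊓ n'
    m = q ⊓ diagSize k
    m≤1+b : m ≤ suc b
    m≤1+b = ≤-trans (m⊓n≤n q (diagSize k)) (diagSize≤ k)
    covered : ∀ x → suc b ∸ m ≤ x × x ≤ b → H.CoveredOn k x
    covered x (low≤x , x≤b) =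
      subst (H.CoveredOn k) (m∸[m∸n]≡n x≤b) (hook-covers (<-≤-trans j<m (m⊓n≤m q _)) (<-≤-trans j<m (m⊓n≤n q _)))
      where
      j<m : b ∸ x < m
      j<m = subst (_≤ m) (+-∸-assoc 1 x≤b) (m≤n+o⇒m∸n≤o (suc b) x (begin
        suc b              ≤⟨ m≤n+m∸n (suc b) m ⟩
        m + (suc b ∸ m)    ≤⟨ +-monoʳ-≤ m low≤x ⟩
        m + x              ≡⟨ +-comm m x ⟩
        x + m              ∎))

module Optimal (n' q' : ℕ) (q'≤n' : q' ≤ n') (Q : Fin (suc q') → QueuePath (suc n'))
  (maximal : (Q′ : Fin (suc q') → QueuePath (suc n')) → Distinct Q′ → coveredCount Q′ ≤ coveredCount Q) where
  open Grid n'
  open Coverage n' q' Q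
  open Hooks n' q' q'≤n' using (hooks; hooks-distinct; hooks-coveredOnDiag; module H)

  capacity : ℕ → ℕ
  capacity k = q ⊓ diagSize k

  coveredOn⇒onGrid : ∀ {k x} → CoveredOn k x → OnGrid k x
  coveredOn⇒onGrid {k} {x} (x≤k , _ , y≤n' , _) =
    m≤n+o⇒m∸n≤o k n' (≤-trans (≤-reflexive (sym (m∸n+n≡m x≤k))) (+-monoˡ-≤ x y≤n')) , x≤k

  -- Points of diagonal kP from x = c on, together with points of diagonal kR left of c, form an antichain.
  spliced≤q : ∀ c kP kR {p r} {P : Pred ℕ p} {R : Pred ℕ r} (P? : Decidable P) (R? : Decidable R) →
    (∀ {x} → P x → CoveredOn kP x) → (∀ {x} → R x → CoveredOn kR x) →
    (∀ {x x'} → x < c → c ≤ x' → R x → P x' → kP ∸ x' < kR ∸ x) →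
    count N (splice c P? R?) ≤ q
  spliced≤q c kP kR {P = P} {R} P? R? P⊆ R⊆ cross = antichain≤q (splice c P? R?) Y covered decreasing
    where
    side : ∀ {x} → Dec (c ≤ x) → ℕ
    side d = if does d then kP else kR
    Y : ℕ → ℕ
    Y x = side (c ≤? x) ∸ x
    side-from : ∀ {x} (d : Dec (c ≤ x)) → c ≤ x → side d ≡ kP
    side-from (yes _) _ = refl
    side-from (no c≰x) c≤x = ⊥-elim (c≰x c≤x)
    side-below : ∀ {x} (d : Dec (c ≤ x)) → x < c → side d ≡ kR
    side-below (yes c≤x) x<c = ⊥-elim (<⇒≱ x<c c≤x)
    side-below (no _) _ = refl
    Y-from : ∀ {x} → c ≤ x → Y x ≡ kP ∸ x
    Y-from {x} c≤x = cong (_∸ x) (side-from (c ≤? x) c≤x)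
    Y-below : ∀ {x} → x < c → Y x ≡ kR ∸ x
    Y-below {x} x<c = cong (_∸ x) (side-below (c ≤? x) x<c)
    covered : ∀ {x} → c ≤ x × P x ⊎ x < c × R x → CoveredAt x (Y x)
    covered {x} (inj₁ (c≤x , p)) = subst (CoveredAt x) (sym (Y-from c≤x)) (proj₂ (P⊆ p))
    covered {x} (inj₂ (x<c , r)) = subst (CoveredAt x) (sym (Y-below x<c)) (proj₂ (R⊆ r))
    decreasing : ∀ {x x'} → x < x' →
                 c ≤ x × P x ⊎ x < c × R x → c ≤ x' × P x' ⊎ x' < c × R x' → Y x' < Y x
    decreasing x<x' (inj₁ (c≤x , _)) (inj₁ (c≤x' , p')) =
      subst₂ _<_ (sym (Y-from c≤x')) (sym (Y-from c≤x)) (∸-monoʳ-< x<x' (proj₁ (P⊆ p')))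
    decreasing x<x' (inj₂ (x<c , _)) (inj₂ (x'<c , r')) =
      subst₂ _<_ (sym (Y-below x'<c)) (sym (Y-below x<c)) (∸-monoʳ-< x<x' (proj₁ (R⊆ r')))
    decreasing x<x' (inj₂ (x<c , r)) (inj₁ (c≤x' , p')) =
      subst₂ _<_ (sym (Y-from c≤x')) (sym (Y-below x<c)) (cross x<c c≤x' r p')
    decreasing x<x' (inj₁ (c≤x , _)) (inj₂ (x'<c , _)) = ⊥-elim (<⇒≱ (<-trans x<x' x'<c) c≤x)

  coveredOnDiag≤capacity : ∀ k → coveredOnDiag k ≤ capacity k
  coveredOnDiag≤capacity k =
    ⊓-glb (antichain≤q (coveredOn? k) (k ∸_) proj₂ (λ x<x' _ (x'≤k , _) → ∸-monoʳ-< x<x' x'≤k))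
          (count-mono (coveredOn? k) (onGrid? k) N (λ _ _ → coveredOn⇒onGrid))

  -- The hooks attain every capacity, so by maximality so does Q.
  coveredOnDiag≡capacity : ∀ {k} → k < N + N → coveredOnDiag k ≡ capacity k
  coveredOnDiag≡capacity {k} = ∑-tight (N + N) (λ k _ → coveredOnDiag≤capacity k) (begin
    ∑ (N + N) capacity              ≤⟨ ∑-mono (N + N) (λ k _ → hooks-coveredOnDiag k) ⟩
    ∑ (N + N) H.coveredOnDiag       ≡⟨ sym H.coveredCount≡∑ ⟩
    coveredCount hooks              ≤⟨ maximal hooks hooks-distinct ⟩
    coveredCount Q                  ≡⟨ coveredCount≡∑ ⟩
    ∑ (N + N) coveredOnDiag         ∎) k
    where open ≤-Reasoning

  full-diagonal : ∀ {k} → k < N + N → diagSize k ≤ q → ∀ t → coveredFrom k t ≡ gridFrom k t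
  full-diagonal {k} k< d≤q t = count-cong (from t (coveredOn? k)) (from t (onGrid? k)) N
    (λ _ _ (t≤x , c) → t≤x , coveredOn⇒onGrid c)
    (λ x x<N (t≤x , g) → t≤x , count-tight (coveredOn? k) (onGrid? k) N (λ _ _ → coveredOn⇒onGrid)
        (≤-reflexive (sym (trans (coveredOnDiag≡capacity k<) (m≥n⇒m⊓n≡n d≤q)))) x x<N g)

  coveredFrom≤gridFrom : ∀ k t → coveredFrom k t ≤ gridFrom k t
  coveredFrom≤gridFrom k t =
    count-mono (from t (coveredOn? k)) (from t (onGrid? k)) N (λ _ _ (t≤x , c) → t≤x , coveredOn⇒onGrid c)

  coveredFrom-low : ∀ k {t} → t ≤ k ∸ n' → coveredFrom k t ≡ coveredOnDiag k
  coveredFrom-low k t≤ = count-cong (from _ (coveredOn? k)) (coveredOn? k) N (λ _ _ → proj₂)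
    (λ _ _ c → ≤-trans t≤ (proj₁ (coveredOn⇒onGrid c)) , c)

  coveredFrom-antitone : ∀ k t → coveredFrom k (suc t) ≤ coveredFrom k t
  coveredFrom-antitone k = count-from-suc (coveredOn? k) N

  -- Path j meets diagonal k at the (j + 1)-th covered point counted from the right.
  pathX : ℕ → ℕ → ℕ
  pathX j k = threshold (coveredFrom k) j n'

  pathX-spec : ∀ {j k} → j < coveredOnDiag k → j < coveredFrom k (pathX j k) × coveredFrom k (suc (pathX j k)) ≤ j
  pathX-spec {j} {k} j<D = threshold-spec n' (coveredFrom k) (coveredFrom-antitone k)
    (≤-trans (≤-reflexive (count-from-beyond (coveredOn? k) N ≤-refl)) z≤n)
    (subst (j <_) (sym (count-from-0 (coveredOn? k) N)) j<D)

  pathX≤ : ∀ {j k a} → j < coveredOnDiag k → coveredFrom k (suc a) ≤ j → pathX j k ≤ a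
  pathX≤ {k = k} j<D ≤j = antitone-cut (coveredFrom k) (coveredFrom-antitone k) ≤j (proj₁ (pathX-spec j<D))

  ≤pathX : ∀ {j k t} → j < coveredOnDiag k → j < coveredFrom k t → t ≤ pathX j k
  ≤pathX {k = k} j<D j< = antitone-cut (coveredFrom k) (coveredFrom-antitone k) (proj₂ (pathX-spec j<D)) j<

  pathX-covered : ∀ {j k} → j < coveredOnDiag k → CoveredOn k (pathX j k)
  pathX-covered {j} {k} j<D = decidable-stable (coveredOn? k (pathX j k)) λ ¬c →
    <⇒≱ (proj₁ (pathX-spec j<D)) (subst (_≤ j) (sym (count-from-skip (coveredOn? k) N ¬c)) (proj₂ (pathX-spec j<D)))

  coveredFrom-next : ∀ {j k t} → suc k < N + N → j < coveredFrom k t → j < capacity (suc k) →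
                     j < coveredFrom (suc k) t
  coveredFrom-next {j} {k} {t} k+1< j<here j<cap with q ≤? diagSize (suc k)
  ... | yes q≤d =
    <-≤-trans j<here (≤-exchange balance (spliced≤q t k (suc k) (coveredOn? k) (coveredOn? (suc k)) id id cross))
    where
    balance : count N (splice t (coveredOn? k) (coveredOn? (suc k))) + coveredFrom (suc k) t ≡ coveredFrom k t + q
    balance = trans (count-splice (coveredOn? k) (coveredOn? (suc k)) N t)
                    (cong (coveredFrom k t +_) (trans (coveredOnDiag≡capacity k+1<) (m≤n⇒m⊓n≡m q≤d)))
    cross : ∀ {x x'} → x < t → t ≤ x' → CoveredOn (suc k) x → CoveredOn k x' → k ∸ x' < suc k ∸ x
    cross {x} x<t t≤x' _ (x'≤k , _) = <-≤-trans (∸-monoʳ-< (<-≤-trans x<t t≤x') x'≤k) (∸-monoˡ-≤ x (n≤1+n k))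
  ... | no q≰d = begin-strict
    j                                  <⟨ ⊓-glb (≤-trans j<here (coveredFrom≤gridFrom k t)) j<d ⟩
    gridFrom k t ⊓ diagSize (suc k)    ≤⟨ gridFrom-suc k t ⟩
    gridFrom (suc k) t                 ≡⟨ sym (full-diagonal k+1< d≤q t) ⟩
    coveredFrom (suc k) t              ∎
    where
    open ≤-Reasoning
    d≤q = <⇒≤ (≰⇒> q≰d)
    j<d = subst (j <_) (m≥n⇒m⊓n≡n d≤q) j<cap

  coveredFrom-prev : ∀ {j k a} → k < N + N → j < capacity k → coveredFrom k (suc a) ≤ j →
                     coveredFrom (suc k) (suc (suc a)) ≤ j
  coveredFrom-prev {j} {k} {a} k< j<cap after≤j with q ≤? diagSize k
  ... | yes q≤d =
    ≤-trans (≤-exchange balance (spliced≤q (suc a) (suc k) k upper (coveredOn? k) proj₂ id cross)) after≤j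
    where
    upper = from (suc (suc a)) (coveredOn? (suc k))
    balance : count N (splice (suc a) upper (coveredOn? k)) + coveredFrom k (suc a) ≡
              coveredFrom (suc k) (suc (suc a)) + q
    balance = trans (count-splice upper (coveredOn? k) N (suc a))
      (cong₂ _+_ (count-cong (from (suc a) upper) upper N (λ _ _ → proj₂) (λ _ _ u@(a+1<x , _) → <⇒≤ a+1<x , u))
                 (trans (coveredOnDiag≡capacity k<) (m≤n⇒m⊓n≡m q≤d)))
    cross : ∀ {x x'} → x < suc a → suc a ≤ x' → CoveredOn k x → suc (suc a) ≤ x' × CoveredOn (suc k) x' →
            suc k ∸ x' < k ∸ x
    cross {x} x≤a _ _ (a+2≤x' , x'≤k+1 , _) = ≤-<-trans
      (∸-monoʳ-≤ (suc k) (≤-trans (s≤s x≤a) a+2≤x'))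
      (∸-monoʳ-< (n<1+n x) (s≤s⁻¹ (≤-trans (s≤s x≤a) (≤-trans a+2≤x' x'≤k+1))))
  ... | no q≰d = ≮⇒≥ λ j<next → <⇒≱ (begin-strict
    j                                                 <⟨ ⊓-glb j<next j<d ⟩
    coveredFrom (suc k) (suc (suc a)) ⊓ diagSize k    ≤⟨ ⊓-monoˡ-≤ _ (coveredFrom≤gridFrom (suc k) (suc (suc a))) ⟩
    gridFrom (suc k) (suc (suc a)) ⊓ diagSize k       ≤⟨ gridFrom-pred k (suc a) ⟩
    gridFrom k (suc a)                                ≡⟨ sym (full-diagonal k< d≤q (suc a)) ⟩
    coveredFrom k (suc a)                             ∎) after≤j
    where
    open ≤-Reasoning
    d≤q = <⇒≤ (≰⇒> q≰d)
    j<d = subst (j <_) (m≥n⇒m⊓n≡n d≤q) j<cap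

  pathX-suc : ∀ {j k} → suc k < N + N → j < coveredOnDiag k → j < coveredOnDiag (suc k) →
              pathX j k ≤ pathX j (suc k) × pathX j (suc k) ≤ suc (pathX j k)
  pathX-suc {j} {k} k+1< j<D j<D' =
    ≤pathX j<D' (coveredFrom-next k+1< (proj₁ (pathX-spec j<D)) (<-≤-trans j<D' (coveredOnDiag≤capacity (suc k)))) ,
    pathX≤ j<D' (coveredFrom-prev (<-trans (n<1+n k) k+1<) (<-≤-trans j<D (coveredOnDiag≤capacity k))
                                  (proj₂ (pathX-spec j<D)))

  pathX-first : ∀ {j} → j < coveredOnDiag j → pathX j j ≡ 0
  pathX-first {j} j<D = n≤0⇒n≡0 (pathX≤ j<D (≤-trans (coveredFrom≤gridFrom j 1)
    (≤-trans (gridFrom≤ j 1) (∸-monoˡ-≤ 1 (m⊓n≤m (suc j) N)))))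

  pathX-last : ∀ {j e} → j + e ≡ n' → j < coveredOnDiag (n' + e) → pathX j (n' + e) ≡ e
  pathX-last {j} {e} je j<D = ≤-antisym
    (pathX≤ j<D (begin
      coveredFrom k (suc e)   ≤⟨ coveredFrom≤gridFrom k (suc e) ⟩
      gridFrom k (suc e)      ≤⟨ gridFrom≤ k (suc e) ⟩
      suc k ⊓ N ∸ suc e       ≤⟨ ∸-monoˡ-≤ (suc e) (m⊓n≤n (suc k) N) ⟩
      n' ∸ e                  ≡⟨ cong (_∸ e) (sym je) ⟩
      j + e ∸ e               ≡⟨ m+n∸n≡m j e ⟩
      j                       ∎))
    (≤pathX j<D (subst (j <_) (sym (coveredFrom-low k (≤-reflexive (sym (m+n∸m≡n n' e))))) j<D))
    where
    open ≤-Reasoning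
    k = n' + e

  path : ℕ → List (Point N)
  path j = Staircase.stair j ((n' ∸ j) + (n' ∸ j)) (λ s → pathX j (j + s))

  module Path (j : ℕ) (j<q : j < q) where
    j≤n' : j ≤ n'
    j≤n' = ≤-trans (s≤s⁻¹ j<q) q'≤n'

    e : ℕ
    e = n' ∸ j

    je : j + e ≡ n'
    je = m+[n∸m]≡n j≤n'

    Z : ℕ → ℕ
    Z s = pathX j (j + s)

    diag< : ∀ {s} → s ≤ e + e → j + s < N + N
    diag< {s} s≤ = s≤s (≤-trans (m≤n+m (j + s) j) (≤-trans (offset≥ j≤n' s≤) (+-monoʳ-≤ n' (n≤1+n n'))))

    on-path : ∀ {s} → s ≤ e + e → j < coveredOnDiag (j + s)
    on-path {s} s≤ = subst (j <_) (sym (coveredOnDiag≡capacity (diag< s≤)))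
      (⊓-glb j<q (<diagSize⇐ (m≤m+n j s) (offset≥ j≤n' s≤)))

    on-path′ : ∀ {s k} → j + s ≡ k → s ≤ e + e → j < coveredOnDiag k
    on-path′ refl = on-path

    in-grid : ∀ s → s ≤ e + e → Z s ≤ j + s × Z s ≤ n' × j + s ∸ Z s ≤ n'
    in-grid s s≤ = let (x≤k , x≤n' , y≤n' , _) = pathX-covered (on-path s≤) in x≤k , x≤n' , y≤n'

    step : ∀ s → s < e + e → Z s ≤ Z (suc s) × Z (suc s) ≤ suc (Z s)
    step s s< = subst (λ k → Z s ≤ pathX j k × pathX j k ≤ suc (Z s)) (sym (+-suc j s))
      (pathX-suc (subst (_< N + N) (+-suc j s) (diag< s<)) (on-path (<⇒≤ s<)) (on-path′ (+-suc j s) s<))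

    Z-first : Z 0 ≡ 0
    Z-first = subst (λ k → pathX j k ≡ 0) (sym (+-identityʳ j)) (pathX-first (on-path′ (+-identityʳ j) z≤n))

    last-diag : j + (e + e) ≡ n' + e
    last-diag = trans (sym (+-assoc j e e)) (cong (_+ e) je)

    Z-last : Z (e + e) ≡ e
    Z-last = subst (λ k → pathX j k ≡ e) (sym last-diag) (pathX-last je (on-path′ last-diag ≤-refl))

  path-spec : ∀ {j} → j < q →
    IsQueuePath (path j) × length (path j) ≡ 2 * N ∸ 1 ∸ 2 * j ×
    HasCoords (head (path j)) 0 j × HasCoords (last (path j)) (n' ∸ j) n'
  path-spec {j} j<q = Staircase.stair-isQueuePath j (e + e) Z in-grid step , length≡ , head≡ , last≡
    where
    open Path j j<q
    length≡ : length (path j) ≡ 2 * N ∸ 1 ∸ 2 * j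
    length≡ = trans (Staircase.stair-length j (e + e) Z)
                    (trans (staircase-length j e) (cong (λ m → 2 * suc m ∸ 1 ∸ 2 * j) je))
    head≡ : HasCoords (head (path j)) 0 j
    head≡ = let (_ , x≤n' , y≤n') = in-grid 0 z≤n in
      subst₂ (HasCoords (head (path j))) Z-first (trans (cong (j + 0 ∸_) Z-first) (+-identityʳ j))
             (Staircase.stair-head j (e + e) Z x≤n' y≤n')
    last≡ : HasCoords (last (path j)) e n'
    last≡ = let (_ , x≤n' , y≤n') = in-grid (e + e) ≤-refl in
      subst₂ (HasCoords (last (path j))) Z-last (trans (cong₂ _∸_ last-diag Z-last) (m+n∸n≡m n' e))
             (Staircase.stair-last j (e + e) Z x≤n' y≤n')

  covered-on-path : ∀ {x y} → CoveredAt x y → ∃ λ r → r < q × pt x y ∈ path r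
  covered-on-path {x} {y} c@(x≤n' , _) =
    r , r<q , subst (_∈ path r) point≡ (Staircase.stair-∋ r (e + e) (λ s → pathX r (r + s)) s≤2e)
    where
    k = x + y
    r = coveredFrom k (suc x)
    e = n' ∸ r
    on : CoveredOn k x
    on = m≤m+n x y , subst (CoveredAt x) (sym (m+n∸m≡n x y)) c
    r<here : r < coveredFrom k x
    r<here = count-from-step (coveredOn? k) N (s≤s x≤n') on
    r<D : r < coveredOnDiag k
    r<D = <-≤-trans r<here (≤-trans (antitone (coveredFrom k) (coveredFrom-antitone k) z≤n)
                                     (≤-reflexive (count-from-0 (coveredOn? k) N)))
    r<cap : r < capacity k
    r<cap = <-≤-trans r<D (coveredOnDiag≤capacity k)
    r<q : r < q
    r<q = <-≤-trans r<cap (m⊓n≤m q (diagSize k))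
    r≤k×r+k≤ : r ≤ k × r + k ≤ n' + n'
    r≤k×r+k≤ = <diagSize⇒ (<-≤-trans r<cap (m⊓n≤n q (diagSize k)))
    s≤2e : k ∸ r ≤ e + e
    s≤2e = offset≤ (≤-trans (s≤s⁻¹ r<q) q'≤n') (proj₁ r≤k×r+k≤) (proj₂ r≤k×r+k≤)
    pathX≡x : pathX r k ≡ x
    pathX≡x = ≤-antisym (pathX≤ r<D ≤-refl) (≤pathX r<D r<here)
    point≡ : pt (pathX r (r + (k ∸ r))) (r + (k ∸ r) ∸ pathX r (r + (k ∸ r))) ≡ pt x y
    point≡ = begin
      pt (pathX r (r + (k ∸ r))) (r + (k ∸ r) ∸ pathX r (r + (k ∸ r)))
        ≡⟨ cong (λ m → pt (pathX r m) (m ∸ pathX r m)) (m+[n∸m]≡n (proj₁ r≤k×r+k≤)) ⟩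
      pt (pathX r k) (k ∸ pathX r k)     ≡⟨ cong (λ z → pt z (k ∸ z)) pathX≡x ⟩
      pt x (k ∸ x)                        ≡⟨ cong (pt x) (m+n∸m≡n x y) ⟩
      pt x y                              ∎
      where open ≡-Reasoning

  paths-cover : (x : Point N) → Covered Q x → ∃ λ i → x ∈ path (toℕ i)
  paths-cover (a , b) cv = on-path (covered-on-path (covered⇒coveredAt cv))
    where
    on-path : (∃ λ r → r < q × pt (toℕ a) (toℕ b) ∈ path r) → ∃ λ i → (a , b) ∈ path (toℕ i)
    on-path (r , r<q , on-r) =
      clamp r , subst₂ (λ p i → p ∈ path i) (pt-toℕ a b) (sym (toℕ-clamp (s≤s⁻¹ r<q))) on-r

proposition3 : (n q : ℕ) → 1 ≤ q → q ≤ n →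
    (Q : Fin q → QueuePath n) → Distinct Q →
    ((Q′ : Fin q → QueuePath n) → Distinct Q′ → coveredCount Q′ ≤ coveredCount Q) →
    Σ (Fin q → List (Point n)) λ p →
      ((i : Fin q) →
        IsQueuePath (p i)
        × length (p i) ≡ 2 * n ∸ 1 ∸ 2 * toℕ i
        × HasCoords (head (p i)) 0 (toℕ i)
        × HasCoords (last (p i)) (n ∸ 1 ∸ toℕ i) (n ∸ 1))
      × ((x : Point n) → Covered Q x → ∃ λ i → x ∈ p i)
proposition3 (suc n') (suc q') _ (s≤s q'≤n') Q _ maximal =
  (λ i → path (toℕ i)) , (λ i → path-spec (toℕ<n i)) , paths-cover
  where open Optimal n' q' q'≤n' Q maximal
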